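{- The category $\mathsf{hIL}$ of h-lattices (with algebra homomorphisms as morphisms) is equivalent to the full subcategory of $\mathsf{KhIL}^{c}$ whose objects satisfy condition (CK): for all $x,y\in T$, if $x\ge\mathsf{c}$, $y\ge\mathsf{c}$ and $x\wedge y\le\mathsf{c}$, then there exists $z\in T$ such that $z\vee\mathsf{c}=x$ and $\sim z\vee\mathsf{c}=y$.
   Context: A Kleene algebra is a bounded distributive lattice $\langle T,\wedge,\vee,0,1\rangle$ with a unary operation $\sim$ such that $\sim\sim x=x$, $\sim(x\wedge y)=\sim x\vee\sim y$ and $(x\wedge\sim x)\wedge(y\vee\sim y)=x\wedge\sim x$. A hemi-Nelson algebra is an algebra $\langle T,\wedge,\vee,\rightarrow,\sim,0,1\rangle$ of type $(2,2,2,1,0,0)$ such that $\langle T,\wedge,\vee,\sim,0,1\rangle$ is a Kleene algebra and for all $x,y,z\in T$: (hN1) $x\rightarrow x=1$; (hN2) $x\wedge(x\rightarrow y)\le x\wedge(\sim x\vee y)$; (hN3) $\sim(x\rightarrow y)\rightarrow(x\wedge\sim y)=1$; (hN4) $(x\wedge\sim y)\rightarrow\sim(x\rightarrow y)=1$; (hN5) $(x\wedge y\wedge(x\rightarrow y))\rightarrow(x\wedge(x\rightarrow y))=1$; (hN6) $(x\wedge(x\rightarrow y))\rightarrow(x\wedge y\wedge(x\rightarrow y))=1$; (hN7) if $x\rightarrow y=1$, $y\rightarrow x=1$, $y\rightarrow z=1$ and $z\rightarrow y=1$ then $x\rightarrow z=1$ and $z\rightarrow x=1$; (hN8) if $x\rightarrow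 y=1$ and $y\rightarrow x=1$ then $(x\wedge z)\rightarrow(y\wedge z)=1$; (hN9) if $x\rightarrow y=1$ and $y\rightarrow x=1$ then $(x\vee z)\rightarrow(y\vee z)=1$; (hN10) if $x\rightarrow y=1$ and $y\rightarrow x=1$ then $(x\rightarrow z)\rightarrow(y\rightarrow z)=1$ and $(z\rightarrow x)\rightarrow(z\rightarrow y)=1$. A centered hemi-Nelson algebra is an algebra $\langle T,\wedge,\vee,\rightarrow,\sim,0,1,\mathsf{c}\rangle$ where $\langle T,\wedge,\vee,\rightarrow,\sim,0,1\rangle$ is a hemi-Nelson algebra and $\mathsf{c}$ is a constant with $\sim\mathsf{c}=\mathsf{c}$; $\mathsf{KhIL}^{c}$ denotes the category of centered hemi-Nelson algebras with algebra homomorphisms (of this signature) as morphisms. An h-lattice is an algebra $\langle A,\wedge,\vee,\rightarrow,0,1\rangle$ of type $(2,2,2,0,0)$ such that $\langle A,\wedge,\vee,0,1\rangle$ is a bounded distributive lattice, $a\rightarrow a=1$ and $a\wedge(a\rightarrow b)\le b$ for all $a,b$. -}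

module Defs where

open import Level using (Level; _⊔_) renaming (suc to lsuc)
open import Data.Product using (Σ; Σ-syntax; ∃-syntax; _×_; _,_; proj₁; proj₂)
open import Relation.Binary.Core using (Rel)
open import Relation.Binary.Structures using (IsEquivalence)
open import Algebra.Core using (Op₁; Op₂)
open import Algebra.Definitions using (Identity; Congruent₁; Congruent₂)
open import Algebra.Lattice.Structures using (IsDistributiveLattice; IsLattice)

record IsBoundedDistributiveLattice {ℓ} {A : Set ℓ} (_≈_ : Rel A ℓ)
         (_∧_ _∨_ : Op₂ A) (𝟘 𝟙 : A) : Set ℓ where
  field
    isDistributiveLattice : IsDistributiveLattice _≈_ _∨_ _∧_
    ∨-identity            : Identity _≈_ 𝟘 _∨_
    ∧-identity            : Identity _≈_ 𝟙 _∧_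

  open IsDistributiveLattice isDistributiveLattice public

record HLattice (ℓ : Level) : Set (lsuc ℓ) where
  infixr 6 _∧_
  infixr 5 _∨_
  infixr 4 _⇒_
  infix 3 _≈_ _≤_
  field
    Carrier : Set ℓ
    _≈_     : Rel Carrier ℓ
    _∧_ _∨_ _⇒_ : Op₂ Carrier
    𝟘 𝟙     : Carrier

  _≤_ : Rel Carrier ℓ
  x ≤ y = (x ∧ y) ≈ x

  field
    isBDL  : IsBoundedDistributiveLattice _≈_ _∧_ _∨_ 𝟘 𝟙
    ⇒-cong : Congruent₂ _≈_ _⇒_
    ⇒-refl : ∀ a → (a ⇒ a) ≈ 𝟙
    ⇒-mp   : ∀ a b → (a ∧ (a ⇒ b)) ≤ b

  open IsBoundedDistributiveLattice isBDL public

record HLatticeHom {ℓ} (A B : HLattice ℓ) : Set ℓ where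
  private
    module A = HLattice A
    module B = HLattice B
  field
    fun   : A.Carrier → B.Carrier
    cong  : ∀ {x y} → x A.≈ y → fun x B.≈ fun y
    hom-∧ : ∀ x y → fun (x A.∧ y) B.≈ (fun x B.∧ fun y)
    hom-∨ : ∀ x y → fun (x A.∨ y) B.≈ (fun x B.∨ fun y)
    hom-⇒ : ∀ x y → fun (x A.⇒ y) B.≈ (fun x B.⇒ fun y)
    hom-𝟘 : fun A.𝟘 B.≈ B.𝟘
    hom-𝟙 : fun A.𝟙 B.≈ B.𝟙

record CHNAlgebra (ℓ : Level) : Set (lsuc ℓ) where
  infixr 6 _∧_
  infixr 5 _∨_
  infixr 4 _⇒_
  infix 3 _≈_ _≤_
  field
    Carrier : Set ℓ
    _≈_     : Rel Carrier ℓ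
    _∧_ _∨_ _⇒_ : Op₂ Carrier
    ∼       : Op₁ Carrier
    𝟘 𝟙     : Carrier
    𝕔       : Carrier

  _≤_ : Rel Carrier ℓ
  x ≤ y = (x ∧ y) ≈ x

  field
    isBDL   : IsBoundedDistributiveLattice _≈_ _∧_ _∨_ 𝟘 𝟙
    ∼-cong  : Congruent₁ _≈_ ∼
    ⇒-cong  : Congruent₂ _≈_ _⇒_
    ∼-invol : ∀ x → ∼ (∼ x) ≈ x
    ∼-∧     : ∀ x y → ∼ (x ∧ y) ≈ (∼ x ∨ ∼ y)
    kleene  : ∀ x y → ((x ∧ ∼ x) ∧ (y ∨ ∼ y)) ≈ (x ∧ ∼ x)
    hN1 : ∀ x → (x ⇒ x) ≈ 𝟙
    hN2 : ∀ x y → (x ∧ (x ⇒ y)) ≤ (x ∧ (∼ x ∨ y))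
    hN3 : ∀ x y → (∼ (x ⇒ y) ⇒ (x ∧ ∼ y)) ≈ 𝟙
    hN4 : ∀ x y → ((x ∧ ∼ y) ⇒ ∼ (x ⇒ y)) ≈ 𝟙
    hN5 : ∀ x y → ((x ∧ y ∧ (x ⇒ y)) ⇒ (x ∧ (x ⇒ y))) ≈ 𝟙
    hN6 : ∀ x y → ((x ∧ (x ⇒ y)) ⇒ (x ∧ y ∧ (x ⇒ y))) ≈ 𝟙
    hN7 : ∀ x y z → (x ⇒ y) ≈ 𝟙 → (y ⇒ x) ≈ 𝟙 → (y ⇒ z) ≈ 𝟙 → (z ⇒ y) ≈ 𝟙 →
          ((x ⇒ z) ≈ 𝟙) × ((z ⇒ x) ≈ 𝟙)
    hN8 : ∀ x y z → (x ⇒ y) ≈ 𝟙 → (y ⇒ x) ≈ 𝟙 → ((x ∧ z) ⇒ (y ∧ z)) ≈ 𝟙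
    hN9 : ∀ x y z → (x ⇒ y) ≈ 𝟙 → (y ⇒ x) ≈ 𝟙 → ((x ∨ z) ⇒ (y ∨ z)) ≈ 𝟙
    hN10 : ∀ x y z → (x ⇒ y) ≈ 𝟙 → (y ⇒ x) ≈ 𝟙 →
           (((x ⇒ z) ⇒ (y ⇒ z)) ≈ 𝟙) × (((z ⇒ x) ⇒ (z ⇒ y)) ≈ 𝟙)
    ∼𝕔 : ∼ 𝕔 ≈ 𝕔

  open IsBoundedDistributiveLattice isBDL public

record CHNHom {ℓ} (A B : CHNAlgebra ℓ) : Set ℓ where
  private
    module A = CHNAlgebra A
    module B = CHNAlgebra B
  field
    fun   : A.Carrier → B.Carrier
    cong  : ∀ {x y} → x A.≈ y → fun x B.≈ fun y
    hom-∧ : ∀ x y → fun (x A.∧ y) B.≈ (fun x B.∧ fun y)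
    hom-∨ : ∀ x y → fun (x A.∨ y) B.≈ (fun x B.∨ fun y)
    hom-⇒ : ∀ x y → fun (x A.⇒ y) B.≈ (fun x B.⇒ fun y)
    hom-∼ : ∀ x → fun (A.∼ x) B.≈ B.∼ (fun x)
    hom-𝟘 : fun A.𝟘 B.≈ B.𝟘
    hom-𝟙 : fun A.𝟙 B.≈ B.𝟙
    hom-𝕔 : fun A.𝕔 B.≈ B.𝕔

CK : ∀ {ℓ} → CHNAlgebra ℓ → Set ℓ
CK T = ∀ x y → 𝕔 ≤ x → 𝕔 ≤ y → (x ∧ y) ≤ 𝕔 →
       Σ[ z ∈ Carrier ] (((z ∨ 𝕔) ≈ x) × ((∼ z ∨ 𝕔) ≈ y))
  where open CHNAlgebra T

record Category (o h e : Level) : Set (lsuc (o ⊔ h ⊔ e)) where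
  infix  4 _≈_
  infixr 9 _∘_
  field
    Obj   : Set o
    Hom   : Obj → Obj → Set h
    _≈_   : ∀ {A B} → Rel (Hom A B) e
    id    : ∀ {A} → Hom A A
    _∘_   : ∀ {A B C} → Hom B C → Hom A B → Hom A C
    ≈-equiv : ∀ {A B} → IsEquivalence (_≈_ {A} {B})
    ∘-cong  : ∀ {A B C} {f f′ : Hom B C} {g g′ : Hom A B} →
              f ≈ f′ → g ≈ g′ → (f ∘ g) ≈ (f′ ∘ g′)
    assoc     : ∀ {A B C D} {f : Hom A B} {g : Hom B C} {h : Hom C D} →
                ((h ∘ g) ∘ f) ≈ (h ∘ (g ∘ f))
    identityˡ : ∀ {A B} {f : Hom A B} → (id ∘ f) ≈ f
    identityʳ : ∀ {A B} {f : Hom A B} → (f ∘ id) ≈ f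

record Functor {o h e o′ h′ e′} (C : Category o h e) (D : Category o′ h′ e′)
       : Set (o ⊔ h ⊔ e ⊔ o′ ⊔ h′ ⊔ e′) where
  private
    module C = Category C
    module D = Category D
  field
    F₀ : C.Obj → D.Obj
    F₁ : ∀ {A B} → C.Hom A B → D.Hom (F₀ A) (F₀ B)
    F-resp-≈ : ∀ {A B} {f g : C.Hom A B} → f C.≈ g → F₁ f D.≈ F₁ g
    F-id     : ∀ {A} → F₁ (C.id {A}) D.≈ D.id
    F-∘      : ∀ {A B C′} {f : C.Hom A B} {g : C.Hom B C′} →
               F₁ (g C.∘ f) D.≈ (F₁ g D.∘ F₁ f)

idF : ∀ {o h e} (C : Category o h e) → Functor C C
idF C = record
  { F₀ = λ A → A ; F₁ = λ f → f ; F-resp-≈ = λ p → p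
  ; F-id = IsEquivalence.refl ≈-equiv ; F-∘ = IsEquivalence.refl ≈-equiv }
  where open Category C

_∘F_ : ∀ {o h e o′ h′ e′ o″ h″ e″}
         {C : Category o h e} {D : Category o′ h′ e′} {E : Category o″ h″ e″} →
         Functor D E → Functor C D → Functor C E
_∘F_ {E = E} G F = record
  { F₀ = λ A → G.F₀ (F.F₀ A)
  ; F₁ = λ f → G.F₁ (F.F₁ f)
  ; F-resp-≈ = λ p → G.F-resp-≈ (F.F-resp-≈ p)
  ; F-id = IsEquivalence.trans E.≈-equiv (G.F-resp-≈ F.F-id) G.F-id
  ; F-∘ = IsEquivalence.trans E.≈-equiv (G.F-resp-≈ F.F-∘) G.F-∘ }
  where
    module G = Functor G
    module F = Functor F
    module E = Category E

record NaturalIsomorphism {o h e o′ h′ e′} {C : Category o h e} {D : Category o′ h′ e′}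
       (F G : Functor C D) : Set (o ⊔ h ⊔ e ⊔ o′ ⊔ h′ ⊔ e′) where
  private
    module C = Category C
    module D = Category D
    module F = Functor F
    module G = Functor G
  field
    η    : ∀ X → D.Hom (F.F₀ X) (G.F₀ X)
    η⁻¹  : ∀ X → D.Hom (G.F₀ X) (F.F₀ X)
    isoˡ : ∀ X → (η⁻¹ X D.∘ η X) D.≈ D.id
    isoʳ : ∀ X → (η X D.∘ η⁻¹ X) D.≈ D.id
    commute : ∀ {X Y} (f : C.Hom X Y) → (η Y D.∘ F.F₁ f) D.≈ (G.F₁ f D.∘ η X)

record CategoryEquivalence {o h e o′ h′ e′} (C : Category o h e) (D : Category o′ h′ e′)
       : Set (o ⊔ h ⊔ e ⊔ o′ ⊔ h′ ⊔ e′) where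
  field
    F : Functor C D
    G : Functor D C
    unit   : NaturalIsomorphism (idF C) (G ∘F F)
    counit : NaturalIsomorphism (F ∘F G) (idF D)

hIL : ∀ ℓ → Category (lsuc ℓ) ℓ ℓ
hIL ℓ = record
  { Obj = HLattice ℓ
  ; Hom = HLatticeHom
  ; _≈_ = λ {A} {B} f g → ∀ x → HLattice._≈_ B (HLatticeHom.fun f x) (HLatticeHom.fun g x)
  ; id = λ {A} → idH A
  ; _∘_ = compH
  ; ≈-equiv = λ {A} {B} → record
      { refl = λ x → reflB B
      ; sym = λ p x → IsEquivalence.sym (isEqB B) (p x)
      ; trans = λ p q x → IsEquivalence.trans (isEqB B) (p x) (q x) }
  ; ∘-cong = λ {A} {B} {C} {f} {f′} {g} {g′} p q x →
      IsEquivalence.trans (isEqB C) (HLatticeHom.cong f (q x)) (p (HLatticeHom.fun g′ x))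
  ; assoc = λ {D = D} x → reflB D
  ; identityˡ = λ {B = B} x → reflB B
  ; identityʳ = λ {B = B} x → reflB B
  }
  where
    isEqB : (B : HLattice ℓ) → IsEquivalence (HLattice._≈_ B)
    isEqB B = IsLattice.isEquivalence (HLattice.isLattice B)
    reflB : (B : HLattice ℓ) → ∀ {x} → HLattice._≈_ B x x
    reflB B = IsEquivalence.refl (isEqB B)
    idH : ∀ A → HLatticeHom A A
    idH A = record
      { fun = λ x → x ; cong = λ p → p
      ; hom-∧ = λ _ _ → reflB A ; hom-∨ = λ _ _ → reflB A ; hom-⇒ = λ _ _ → reflB A
      ; hom-𝟘 = reflB A ; hom-𝟙 = reflB A }
    compH : ∀ {A B C} → HLatticeHom B C → HLatticeHom A B → HLatticeHom A C
    compH {A} {B} {C} g f = record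
      { fun = λ x → G.fun (F.fun x)
      ; cong = λ p → G.cong (F.cong p)
      ; hom-∧ = λ x y → tr (G.cong (F.hom-∧ x y)) (G.hom-∧ _ _)
      ; hom-∨ = λ x y → tr (G.cong (F.hom-∨ x y)) (G.hom-∨ _ _)
      ; hom-⇒ = λ x y → tr (G.cong (F.hom-⇒ x y)) (G.hom-⇒ _ _)
      ; hom-𝟘 = tr (G.cong F.hom-𝟘) G.hom-𝟘
      ; hom-𝟙 = tr (G.cong F.hom-𝟙) G.hom-𝟙 }
      where
        module G = HLatticeHom g
        module F = HLatticeHom f
        tr = IsEquivalence.trans (isEqB C)

KhILcCK : ∀ ℓ → Category (lsuc ℓ) ℓ ℓ
KhILcCK ℓ = record
  { Obj = Σ[ T ∈ CHNAlgebra ℓ ] CK T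
  ; Hom = λ A B → CHNHom (proj₁ A) (proj₁ B)
  ; _≈_ = λ {A} {B} f g → ∀ x → CHNAlgebra._≈_ (proj₁ B) (CHNHom.fun f x) (CHNHom.fun g x)
  ; id = λ {A} → idH (proj₁ A)
  ; _∘_ = λ {A} {B} {C} g f → compH {A} {B} {C} g f
  ; ≈-equiv = λ {A} {B} → record
      { refl = λ x → reflB (proj₁ B)
      ; sym = λ p x → IsEquivalence.sym (isEqB (proj₁ B)) (p x)
      ; trans = λ p q x → IsEquivalence.trans (isEqB (proj₁ B)) (p x) (q x) }
  ; ∘-cong = λ {A} {B} {C} {f} {f′} {g} {g′} p q x →
      IsEquivalence.trans (isEqB (proj₁ C)) (CHNHom.cong f (q x)) (p (CHNHom.fun g′ x))
  ; assoc = λ {D = D} x → reflB (proj₁ D)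
  ; identityˡ = λ {B = B} x → reflB (proj₁ B)
  ; identityʳ = λ {B = B} x → reflB (proj₁ B)
  }
  where
    isEqB : (B : CHNAlgebra ℓ) → IsEquivalence (CHNAlgebra._≈_ B)
    isEqB B = IsLattice.isEquivalence (CHNAlgebra.isLattice B)
    reflB : (B : CHNAlgebra ℓ) → ∀ {x} → CHNAlgebra._≈_ B x x
    reflB B = IsEquivalence.refl (isEqB B)
    idH : ∀ A → CHNHom A A
    idH A = record
      { fun = λ x → x ; cong = λ p → p
      ; hom-∧ = λ _ _ → reflB A ; hom-∨ = λ _ _ → reflB A ; hom-⇒ = λ _ _ → reflB A
      ; hom-∼ = λ _ → reflB A
      ; hom-𝟘 = reflB A ; hom-𝟙 = reflB A ; hom-𝕔 = reflB A }
    compH : ∀ {A B C : Σ[ T ∈ CHNAlgebra ℓ ] CK T} →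
            CHNHom (proj₁ B) (proj₁ C) → CHNHom (proj₁ A) (proj₁ B) →
            CHNHom (proj₁ A) (proj₁ C)
    compH {A} {B} {C} g f = record
      { fun = λ x → G.fun (F.fun x)
      ; cong = λ p → G.cong (F.cong p)
      ; hom-∧ = λ x y → tr (G.cong (F.hom-∧ x y)) (G.hom-∧ _ _)
      ; hom-∨ = λ x y → tr (G.cong (F.hom-∨ x y)) (G.hom-∨ _ _)
      ; hom-⇒ = λ x y → tr (G.cong (F.hom-⇒ x y)) (G.hom-⇒ _ _)
      ; hom-∼ = λ x → tr (G.cong (F.hom-∼ x)) (G.hom-∼ _)
      ; hom-𝟘 = tr (G.cong F.hom-𝟘) G.hom-𝟘
      ; hom-𝟙 = tr (G.cong F.hom-𝟙) G.hom-𝟙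
      ; hom-𝕔 = tr (G.cong F.hom-𝕔) G.hom-𝕔 }
      where
        module G = CHNHom g
        module F = CHNHom f
        tr = IsEquivalence.trans (isEqB (proj₁ C))

{-# OPTIONS --safe #-}
-- Kalman's construction K(A) = {(a, b) ∈ A × A | a ∧ b = 𝟘}, with (a, b) ⇒ (c, d) = (a ⇒ c, a ∧ d),
-- ∼ (a, b) = (b, a) and 𝕔 = (𝟘, 𝟘), makes an h-lattice into a centred hemi-Nelson algebra with
-- (CK): above 𝕔 the second coordinate vanishes. Conversely a centred hemi-Nelson algebra T gives
-- the h-lattice T/𝕔 of elements up to x ∨ 𝕔; the hemi-Nelson axioms make this identification
-- agree with mutual implication (x ⇒ y ≈ 𝟙 ≈ y ⇒ x), so by hN10 ⇒ is well defined on T/𝕔.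
-- The unit a ↦ (a, 𝟘) is clearly an isomorphism A ≅ K(A)/𝕔. For the counit, x ↦ (x, ∼ x) is a
-- homomorphism T → K(T/𝕔); it is injective since x ∧ 𝕔 ≈ ∼ (∼ x ∨ 𝕔) and distributive lattices
-- are cancellative, and (CK) says precisely that it is surjective.
module Submission where

open import Defs
open import Level using (Level) renaming (suc to lsuc)
open import Data.Product using (_×_; _,_; proj₁; proj₂)
open import Function.Definitions using (Injective; StrictlySurjective)
open import Relation.Binary.Core using (Rel)
open import Relation.Binary.Bundles using (Setoid)
open import Relation.Binary.Structures using (IsEquivalence)
open import Algebra.Core using (Op₂)
open import Algebra.Definitions using (Congruent₂)
open import Algebra.Bundles using (IdempotentCommutativeMonoid)
open import Algebra.Lattice.Bundles using (DistributiveLattice)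
import Algebra.Lattice.Properties.DistributiveLattice as DistributiveLatticeProperties
import Algebra.Properties.IdempotentCommutativeMonoid as IdempotentCommutativeMonoidProperties
import Relation.Binary.Lattice.Bundles as Order
import Relation.Binary.Lattice.Properties.JoinSemilattice as JoinSemilatticeProperties
import Relation.Binary.Lattice.Properties.MeetSemilattice as MeetSemilatticeProperties
import Relation.Binary.Reasoning.Setoid as SetoidReasoning
import Relation.Binary.Reasoning.PartialOrder as PosetReasoning

private
  variable
    ℓ : Level

record BoundedDistributiveLattice (a : Level) : Set (lsuc a) where
  infixr 6 _∧_
  infixr 5 _∨_
  infix 3 _≈_
  field
    Carrier : Set a
    _≈_     : Rel Carrier a
    _∧_ _∨_ : Op₂ Carrier
    𝟘 𝟙     : Carrier
    isBoundedDistributiveLattice : IsBoundedDistributiveLattice _≈_ _∧_ _∨_ 𝟘 𝟙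

  open IsBoundedDistributiveLattice isBoundedDistributiveLattice public

  setoid : Setoid a a
  setoid = record { isEquivalence = isEquivalence }

module BoundedDistributiveLatticeProperties {a} (L : BoundedDistributiveLattice a) where

  open BoundedDistributiveLattice L public

  private
    variable
      x y z u v : Carrier

  distributiveLattice : DistributiveLattice a a
  distributiveLattice = record { isDistributiveLattice = isDistributiveLattice }

  open DistributiveLatticeProperties distributiveLattice public
    using (∧-idem; ∨-idem; ∨-isSemigroup; ∨-∧-orderTheoreticLattice)

  private
    module Ord = Order.Lattice ∨-∧-orderTheoreticLattice

  -- x ≤ y unfolds to x ≈ x ∧ y, whereas HLattice and CHNAlgebra write x ∧ y ≈ x; `sym` converts.
  open Ord public
    using (_≤_; poset; x∧y≤x; x∧y≤y; ∧-greatest; y≤x∨y; ∨-least)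
    renaming (refl to ≤-refl; trans to ≤-trans; antisym to ≤-antisym; reflexive to ≤-reflexive)
  open MeetSemilatticeProperties Ord.meetSemilattice public using (∧-monotonic)
  open JoinSemilatticeProperties Ord.joinSemilattice public using (∨-monotonic; x≤y⇒x∨y≈y)

  ∨-identityˡ : ∀ x → 𝟘 ∨ x ≈ x
  ∨-identityˡ = proj₁ ∨-identity

  ∨-identityʳ : ∀ x → x ∨ 𝟘 ≈ x
  ∨-identityʳ = proj₂ ∨-identity

  ∧-identityˡ : ∀ x → 𝟙 ∧ x ≈ x
  ∧-identityˡ = proj₁ ∧-identity

  ∧-identityʳ : ∀ x → x ∧ 𝟙 ≈ x
  ∧-identityʳ = proj₂ ∧-identity

  ∨-idempotentCommutativeMonoid : IdempotentCommutativeMonoid a a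
  ∨-idempotentCommutativeMonoid = record
    { isIdempotentCommutativeMonoid = record
      { isCommutativeMonoid = record
        { isMonoid = record { isSemigroup = ∨-isSemigroup ; identity = ∨-identity }
        ; comm     = ∨-comm }
      ; idem = ∨-idem } }

  open IdempotentCommutativeMonoidProperties ∨-idempotentCommutativeMonoid public
    using () renaming (∙-distrʳ-∙ to ∨-distribʳ-∨)

  Disjoint : Carrier → Carrier → Set a
  Disjoint x y = x ∧ y ≈ 𝟘

  -- Proofs are opaque throughout: checking the counit compares algebras such as K(T/𝕔) field by
  -- field, and unfolding the proof terms stored in those fields makes type checking infeasible.
  opaque
    ∧-zeroˡ : ∀ x → 𝟘 ∧ x ≈ 𝟘
    ∧-zeroˡ x = trans (∧-congˡ (sym (∨-identityˡ x))) (∧-absorbs-∨ 𝟘 x)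

    ∧-zeroʳ : ∀ x → x ∧ 𝟘 ≈ 𝟘
    ∧-zeroʳ x = trans (∧-comm x 𝟘) (∧-zeroˡ x)

    𝟘-minimum : ∀ x → 𝟘 ≤ x
    𝟘-minimum x = sym (∧-zeroˡ x)

    ≈𝟘⇒≤ : x ≈ 𝟘 → x ≤ y
    ≈𝟘⇒≤ x≈𝟘 = ≤-trans (≤-reflexive x≈𝟘) (𝟘-minimum _)

    ∧-∨-cancelʳ : x ∧ z ≈ y ∧ z → x ∨ z ≈ y ∨ z → x ≈ y
    ∧-∨-cancelʳ {x} {z} {y} ∧-eq ∨-eq = begin
      x                    ≈⟨ ∧-absorbs-∨ x z ⟨
      x ∧ (x ∨ z)          ≈⟨ ∧-congˡ ∨-eq ⟩
      x ∧ (y ∨ z)          ≈⟨ ∧-distribˡ-∨ x y z ⟩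
      (x ∧ y) ∨ (x ∧ z)    ≈⟨ ∨-cong (∧-comm x y) ∧-eq ⟩
      (y ∧ x) ∨ (y ∧ z)    ≈⟨ ∧-distribˡ-∨ y x z ⟨
      y ∧ (x ∨ z)          ≈⟨ ∧-congˡ ∨-eq ⟩
      y ∧ (y ∨ z)          ≈⟨ ∧-absorbs-∨ y z ⟩
      y                    ∎
      where open SetoidReasoning setoid

    disjoint-≤ : x ∧ y ≤ u ∧ v → Disjoint u v → Disjoint x y
    disjoint-≤ le disj = ≤-antisym (≤-trans le (≤-reflexive disj)) (𝟘-minimum _)

    disjoint-antitone : x ≤ u → y ≤ v → Disjoint u v → Disjoint x y
    disjoint-antitone x≤u y≤v = disjoint-≤ (∧-monotonic x≤u y≤v)

    disjoint-sym : Disjoint x y → Disjoint y x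
    disjoint-sym {x} {y} disj = trans (∧-comm y x) disj

    disjoint-∨ʳ : Disjoint x y → Disjoint x z → Disjoint x (y ∨ z)
    disjoint-∨ʳ {x} {y} {z} p q = trans (∧-distribˡ-∨ x y z) (trans (∨-cong p q) (∨-identityˡ 𝟘))

    disjoint-∨ˡ : Disjoint x z → Disjoint y z → Disjoint (x ∨ y) z
    disjoint-∨ˡ {x} {z} {y} p q = trans (∧-distribʳ-∨ z x y) (trans (∨-cong p q) (∨-identityˡ 𝟘))

  coarser-isBoundedDistributiveLattice :
    {_~_ : Rel Carrier a} → IsEquivalence _~_ → (∀ {x y} → x ≈ y → x ~ y) →
    Congruent₂ _~_ _∧_ → Congruent₂ _~_ _∨_ →
    IsBoundedDistributiveLattice _~_ _∧_ _∨_ 𝟘 𝟙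
  coarser-isBoundedDistributiveLattice ~-equiv ≈⇒~ ∧-cong~ ∨-cong~ = record
    { isDistributiveLattice = record
      { isLattice = record
        { isEquivalence = ~-equiv
        ; ∨-comm     = λ x y → ≈⇒~ (∨-comm x y)
        ; ∨-assoc    = λ x y z → ≈⇒~ (∨-assoc x y z)
        ; ∨-cong     = ∨-cong~
        ; ∧-comm     = λ x y → ≈⇒~ (∧-comm x y)
        ; ∧-assoc    = λ x y z → ≈⇒~ (∧-assoc x y z)
        ; ∧-cong     = ∧-cong~
        ; absorptive = (λ x y → ≈⇒~ (∨-absorbs-∧ x y)) , (λ x y → ≈⇒~ (∧-absorbs-∨ x y)) }
      ; ∨-distrib-∧ = (λ x y z → ≈⇒~ (∨-distribˡ-∧ x y z)) , (λ x y z → ≈⇒~ (∨-distribʳ-∧ x y z))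
      ; ∧-distrib-∨ = (λ x y z → ≈⇒~ (∧-distribˡ-∨ x y z)) , (λ x y z → ≈⇒~ (∧-distribʳ-∨ x y z)) }
    ; ∨-identity = (λ x → ≈⇒~ (∨-identityˡ x)) , (λ x → ≈⇒~ (∨-identityʳ x))
    ; ∧-identity = (λ x → ≈⇒~ (∧-identityˡ x)) , (λ x → ≈⇒~ (∧-identityʳ x)) }

module _ {o h e o′ h′ e′} {C : Category o h e} {D : Category o′ h′ e′} {F G : Functor C D} where
  private
    module C = Category C
    module F = Functor F
    module G = Functor G
  open Category D

  symNI : NaturalIsomorphism F G → NaturalIsomorphism G F
  symNI α = record { η = η⁻¹ ; η⁻¹ = η ; isoˡ = isoʳ ; isoʳ = isoˡ ; commute = commute⁻¹ }
    where
    open NaturalIsomorphism α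

    commute⁻¹ : ∀ {X Y} (f : C.Hom X Y) → η⁻¹ Y ∘ G.F₁ f ≈ F.F₁ f ∘ η⁻¹ X
    commute⁻¹ {X} {Y} f = begin
      η⁻¹ Y ∘ G.F₁ f                          ≈⟨ identityʳ ⟨
      (η⁻¹ Y ∘ G.F₁ f) ∘ id                   ≈⟨ ∘-cong refl (isoʳ X) ⟨
      (η⁻¹ Y ∘ G.F₁ f) ∘ (η X ∘ η⁻¹ X)        ≈⟨ assoc ⟩
      η⁻¹ Y ∘ (G.F₁ f ∘ (η X ∘ η⁻¹ X))        ≈⟨ ∘-cong refl assoc ⟨
      η⁻¹ Y ∘ ((G.F₁ f ∘ η X) ∘ η⁻¹ X)        ≈⟨ ∘-cong refl (∘-cong (commute f) refl) ⟨
      η⁻¹ Y ∘ ((η Y ∘ F.F₁ f) ∘ η⁻¹ X)        ≈⟨ ∘-cong refl assoc ⟩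
      η⁻¹ Y ∘ (η Y ∘ (F.F₁ f ∘ η⁻¹ X))        ≈⟨ assoc ⟨
      (η⁻¹ Y ∘ η Y) ∘ (F.F₁ f ∘ η⁻¹ X)        ≈⟨ ∘-cong (isoˡ Y) refl ⟩
      id ∘ (F.F₁ f ∘ η⁻¹ X)                   ≈⟨ identityˡ ⟩
      F.F₁ f ∘ η⁻¹ X                          ∎
      where
      hom-setoid : Setoid h′ e′
      hom-setoid = record { isEquivalence = ≈-equiv {G.F₀ X} {F.F₀ Y} }
      open SetoidReasoning hom-setoid
      refl : ∀ {A B} {g : Hom A B} → g ≈ g
      refl = IsEquivalence.refl ≈-equiv

module _ {T U : CHNAlgebra ℓ} (f : CHNHom T U) where
  private
    module T = CHNAlgebra T
    module U = CHNAlgebra U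
  open CHNHom f

  module _ (injective : Injective T._≈_ U._≈_ fun) (surjective : StrictlySurjective U._≈_ fun) where

    inverse : U.Carrier → T.Carrier
    inverse y = proj₁ (surjective y)

    fun∘inverse : ∀ y → fun (inverse y) U.≈ y
    fun∘inverse y = proj₂ (surjective y)

    inverse∘fun : ∀ x → inverse (fun x) T.≈ x
    inverse∘fun x = injective (fun∘inverse (fun x))

    private
      reflect : ∀ {y x} → y U.≈ fun x → inverse y T.≈ x
      reflect y≈fx = injective (U.trans (fun∘inverse _) y≈fx)

      preserves₂ : (_∙ᵀ_ : Op₂ T.Carrier) (_∙ᵁ_ : Op₂ U.Carrier) →
                   (∀ a b → fun (a ∙ᵀ b) U.≈ fun a ∙ᵁ fun b) → Congruent₂ U._≈_ _∙ᵁ_ →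
                   ∀ x y → inverse (x ∙ᵁ y) T.≈ inverse x ∙ᵀ inverse y
      preserves₂ _ _ hom ∙ᵁ-cong x y =
        reflect (U.trans (∙ᵁ-cong (U.sym (fun∘inverse x)) (U.sym (fun∘inverse y)))
                         (U.sym (hom _ _)))

    inverseHom : CHNHom U T
    inverseHom = record
      { fun   = inverse
      ; cong  = λ y≈y′ → reflect (U.trans y≈y′ (U.sym (fun∘inverse _)))
      ; hom-∧ = preserves₂ T._∧_ U._∧_ hom-∧ U.∧-cong
      ; hom-∨ = preserves₂ T._∨_ U._∨_ hom-∨ U.∨-cong
      ; hom-⇒ = preserves₂ T._⇒_ U._⇒_ hom-⇒ U.⇒-cong
      ; hom-∼ = λ y → reflect (U.trans (U.∼-cong (U.sym (fun∘inverse y))) (U.sym (hom-∼ _)))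
      ; hom-𝟘 = reflect (U.sym hom-𝟘)
      ; hom-𝟙 = reflect (U.sym hom-𝟙)
      ; hom-𝕔 = reflect (U.sym hom-𝕔) }

module HLatticeProperties (A : HLattice ℓ) where
  open HLattice A public using (_⇒_; ⇒-cong; ⇒-refl)

  boundedDistributiveLattice : BoundedDistributiveLattice ℓ
  boundedDistributiveLattice = record { isBoundedDistributiveLattice = HLattice.isBDL A }

  open BoundedDistributiveLatticeProperties boundedDistributiveLattice public

  private
    variable
      a b c : Carrier

  opaque
    ⇒-mp-≤ : ∀ a b → a ∧ (a ⇒ b) ≤ b
    ⇒-mp-≤ a b = sym (HLattice.⇒-mp A a b)

    ∧-⇒-absorbs : ∀ a b → a ∧ (a ⇒ b) ≈ a ∧ b ∧ (a ⇒ b)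
    ∧-⇒-absorbs a b = ≤-antisym
      (∧-greatest (x∧y≤x _ _) (∧-greatest (⇒-mp-≤ a b) (x∧y≤y _ _)))
      (∧-monotonic ≤-refl (x∧y≤y _ _))

    ≈⇒⇒≈𝟙 : a ≈ b → (a ⇒ b) ≈ 𝟙
    ≈⇒⇒≈𝟙 {a} a≈b = trans (⇒-cong refl (sym a≈b)) (⇒-refl a)

    ⇒≈𝟙⇒≤ : (a ⇒ b) ≈ 𝟙 → a ≤ b
    ⇒≈𝟙⇒≤ {a} {b} a⇒b≈𝟙 = begin
      a            ≈⟨ ∧-identityʳ a ⟨
      a ∧ 𝟙        ≈⟨ ∧-congˡ a⇒b≈𝟙 ⟨
      a ∧ (a ⇒ b)  ≤⟨ ⇒-mp-≤ a b ⟩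
      b            ∎
      where open PosetReasoning poset

    ⇒≈𝟙-antisym : (a ⇒ b) ≈ 𝟙 → (b ⇒ a) ≈ 𝟙 → a ≈ b
    ⇒≈𝟙-antisym a⇒b≈𝟙 b⇒a≈𝟙 = ≤-antisym (⇒≈𝟙⇒≤ a⇒b≈𝟙) (⇒≈𝟙⇒≤ b⇒a≈𝟙)

    disjoint-⇒ : Disjoint b c → Disjoint (a ⇒ b) (a ∧ c)
    disjoint-⇒ {b} {c} {a} = disjoint-≤ (begin
      (a ⇒ b) ∧ a ∧ c    ≈⟨ ∧-assoc _ _ _ ⟨
      ((a ⇒ b) ∧ a) ∧ c  ≈⟨ ∧-congʳ (∧-comm _ _) ⟩
      (a ∧ (a ⇒ b)) ∧ c  ≤⟨ ∧-monotonic (⇒-mp-≤ a b) ≤-refl ⟩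
      b ∧ c              ∎)
      where open PosetReasoning poset

module Kalman (A : HLattice ℓ) where
  open HLatticeProperties A

  record Pair : Set ℓ where
    constructor pair
    field
      fst snd  : Carrier
      disjoint : Disjoint fst snd
  open Pair public

  infixr 6 _∧K_
  infixr 5 _∨K_
  infixr 4 _⇒K_
  infix 3 _≈K_

  _≈K_ : Rel Pair ℓ
  X ≈K Y = (fst X ≈ fst Y) × (snd X ≈ snd Y)

  _∧K_ _∨K_ _⇒K_ : Op₂ Pair
  pair a b p ∧K pair c d q = pair (a ∧ c) (b ∨ d)
    (disjoint-∨ʳ (disjoint-antitone (x∧y≤x a c) ≤-refl p) (disjoint-antitone (x∧y≤y a c) ≤-refl q))
  pair a b p ∨K pair c d q = pair (a ∨ c) (b ∧ d)
    (disjoint-∨ˡ (disjoint-antitone ≤-refl (x∧y≤x b d) p) (disjoint-antitone ≤-refl (x∧y≤y b d) q))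
  pair a b p ⇒K pair c d q = pair (a ⇒ c) (a ∧ d) (disjoint-⇒ q)

  ∼K : Pair → Pair
  ∼K (pair a b p) = pair b a (disjoint-sym p)

  𝟘K 𝟙K 𝕔K : Pair
  𝟘K = pair 𝟘 𝟙 (∧-identityʳ 𝟘)
  𝟙K = pair 𝟙 𝟘 (∧-identityˡ 𝟘)
  𝕔K = pair 𝟘 𝟘 (∧-idem 𝟘)

  opaque
    isBoundedDistributiveLatticeK : IsBoundedDistributiveLattice _≈K_ _∧K_ _∨K_ 𝟘K 𝟙K
    isBoundedDistributiveLatticeK = record
      { isDistributiveLattice = record
        { isLattice = record
          { isEquivalence = record
            { refl  = refl , refl
            ; sym   = λ (p , q) → sym p , sym q
            ; trans = λ (p , q) (p′ , q′) → trans p p′ , trans q q′ }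
          ; ∨-comm     = λ X Y → ∨-comm (fst X) (fst Y) , ∧-comm (snd X) (snd Y)
          ; ∨-assoc    = λ X Y Z → ∨-assoc (fst X) (fst Y) (fst Z) , ∧-assoc (snd X) (snd Y) (snd Z)
          ; ∨-cong     = λ (p , q) (p′ , q′) → ∨-cong p p′ , ∧-cong q q′
          ; ∧-comm     = λ X Y → ∧-comm (fst X) (fst Y) , ∨-comm (snd X) (snd Y)
          ; ∧-assoc    = λ X Y Z → ∧-assoc (fst X) (fst Y) (fst Z) , ∨-assoc (snd X) (snd Y) (snd Z)
          ; ∧-cong     = λ (p , q) (p′ , q′) → ∧-cong p p′ , ∨-cong q q′
          ; absorptive = (λ X Y → ∨-absorbs-∧ (fst X) (fst Y) , ∧-absorbs-∨ (snd X) (snd Y))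
                       , (λ X Y → ∧-absorbs-∨ (fst X) (fst Y) , ∨-absorbs-∧ (snd X) (snd Y)) }
        ; ∨-distrib-∧ =
            (λ X Y Z → ∨-distribˡ-∧ (fst X) (fst Y) (fst Z) , ∧-distribˡ-∨ (snd X) (snd Y) (snd Z)) ,
            (λ X Y Z → ∨-distribʳ-∧ (fst X) (fst Y) (fst Z) , ∧-distribʳ-∨ (snd X) (snd Y) (snd Z))
        ; ∧-distrib-∨ =
            (λ X Y Z → ∧-distribˡ-∨ (fst X) (fst Y) (fst Z) , ∨-distribˡ-∧ (snd X) (snd Y) (snd Z)) ,
            (λ X Y Z → ∧-distribʳ-∨ (fst X) (fst Y) (fst Z) , ∨-distribʳ-∧ (snd X) (snd Y) (snd Z)) }
      ; ∨-identity = (λ X → ∨-identityˡ (fst X) , ∧-identityˡ (snd X))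
                   , (λ X → ∨-identityʳ (fst X) , ∧-identityʳ (snd X))
      ; ∧-identity = (λ X → ∧-identityˡ (fst X) , ∨-identityˡ (snd X))
                   , (λ X → ∧-identityʳ (fst X) , ∨-identityʳ (snd X)) }

    ≤K-intro : ∀ X Y → fst X ≤ fst Y → snd Y ≤ snd X → X ∧K Y ≈K X
    ≤K-intro X Y fst≤ snd≤ = sym fst≤ , trans (∨-comm (snd X) (snd Y)) (x≤y⇒x∨y≈y snd≤)

    ⇒K≈𝟙K-intro : ∀ X Y → fst X ≈ fst Y → X ⇒K Y ≈K 𝟙K
    ⇒K≈𝟙K-intro X Y e = ≈⇒⇒≈𝟙 e , trans (∧-congʳ e) (disjoint Y)

  algebra : CHNAlgebra ℓ
  algebra = record
    { Carrier = Pair ; _≈_ = _≈K_ ; _∧_ = _∧K_ ; _∨_ = _∨K_ ; _⇒_ = _⇒K_ ; ∼ = ∼K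
    ; 𝟘 = 𝟘K ; 𝟙 = 𝟙K ; 𝕔 = 𝕔K
    ; isBDL   = isBoundedDistributiveLatticeK
    ; ∼-cong  = λ (p , q) → q , p
    ; ⇒-cong  = λ (p , _) (p′ , q′) → ⇒-cong p p′ , ∧-cong p q′
    ; ∼-invol = λ _ → refl , refl
    ; ∼-∧     = λ _ _ → refl , refl
    ; kleene  = λ X Y → ≤K-intro (X ∧K ∼K X) (Y ∨K ∼K Y)
                          (≈𝟘⇒≤ (disjoint X)) (≈𝟘⇒≤ (disjoint-sym (disjoint Y)))
    ; hN1  = λ X → ⇒K≈𝟙K-intro X X refl
    ; hN2  = λ X Y → ≤K-intro (X ∧K (X ⇒K Y)) (X ∧K (∼K X ∨K Y))
                       (∧-greatest (x∧y≤x _ _) (≤-trans (⇒-mp-≤ _ _) (y≤x∨y _ _))) ≤-refl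
    ; hN3  = λ X Y → ⇒K≈𝟙K-intro (∼K (X ⇒K Y)) (X ∧K ∼K Y) refl
    ; hN4  = λ X Y → ⇒K≈𝟙K-intro (X ∧K ∼K Y) (∼K (X ⇒K Y)) refl
    ; hN5  = λ X Y → ⇒K≈𝟙K-intro (X ∧K Y ∧K (X ⇒K Y)) (X ∧K (X ⇒K Y)) (sym (∧-⇒-absorbs _ _))
    ; hN6  = λ X Y → ⇒K≈𝟙K-intro (X ∧K (X ⇒K Y)) (X ∧K Y ∧K (X ⇒K Y)) (∧-⇒-absorbs _ _)
    ; hN7  = λ X Y Z (p , _) (q , _) (p′ , _) (q′ , _) →
               let X≈Z = trans (⇒≈𝟙-antisym p q) (⇒≈𝟙-antisym p′ q′)
               in ⇒K≈𝟙K-intro X Z X≈Z , ⇒K≈𝟙K-intro Z X (sym X≈Z)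
    ; hN8  = λ X Y Z (p , _) (q , _) → ⇒K≈𝟙K-intro (X ∧K Z) (Y ∧K Z) (∧-congʳ (⇒≈𝟙-antisym p q))
    ; hN9  = λ X Y Z (p , _) (q , _) → ⇒K≈𝟙K-intro (X ∨K Z) (Y ∨K Z) (∨-congʳ (⇒≈𝟙-antisym p q))
    ; hN10 = λ X Y Z (p , _) (q , _) →
               ⇒K≈𝟙K-intro (X ⇒K Z) (Y ⇒K Z) (⇒-cong (⇒≈𝟙-antisym p q) refl) ,
               ⇒K≈𝟙K-intro (Z ⇒K X) (Z ⇒K Y) (⇒-cong refl (⇒≈𝟙-antisym p q))
    ; ∼𝕔 = refl , refl }

  opaque
    fst≈⇒∨𝕔K≈ : ∀ X Y → fst X ≈ fst Y → X ∨K 𝕔K ≈K Y ∨K 𝕔K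
    fst≈⇒∨𝕔K≈ X Y e = ∨-congʳ e , trans (∧-zeroʳ (snd X)) (sym (∧-zeroʳ (snd Y)))

    ∨𝕔K≈⇒fst≈ : ∀ X Y → X ∨K 𝕔K ≈K Y ∨K 𝕔K → fst X ≈ fst Y
    ∨𝕔K≈⇒fst≈ X Y (e , _) = trans (sym (∨-identityʳ (fst X))) (trans e (∨-identityʳ (fst Y)))

    -- Above 𝕔K the second coordinates vanish, so the data are (a, 𝟘) and (c, 𝟘) with a ∧ c ≈ 𝟘.
    isCK : CK algebra
    isCK (pair a b _) (pair c d _) (_ , 𝟘∨b≈𝟘) (_ , 𝟘∨d≈𝟘) (a∧c∧𝟘≈a∧c , _) =
      pair a c (trans (sym a∧c∧𝟘≈a∧c) (∧-zeroʳ _)) ,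
      (∨-identityʳ a , trans (∧-zeroʳ c) (trans (sym 𝟘∨b≈𝟘) (∨-identityˡ b))) ,
      (∨-identityʳ c , trans (∧-zeroʳ a) (trans (sym 𝟘∨d≈𝟘) (∨-identityˡ d)))

module HemiNelsonProperties (T : CHNAlgebra ℓ) where
  open CHNAlgebra T public
    using ( _⇒_; ∼; 𝕔; ∼-cong; ⇒-cong; ∼-invol; ∼-∧; ∼𝕔
          ; hN1; hN2; hN3; hN4; hN5; hN6; hN7; hN9; hN10 )

  boundedDistributiveLattice : BoundedDistributiveLattice ℓ
  boundedDistributiveLattice = record { isBoundedDistributiveLattice = CHNAlgebra.isBDL T }

  open BoundedDistributiveLatticeProperties boundedDistributiveLattice public

  private
    variable
      x y z x′ y′ : Carrier

  infix 3 _~_ _⇔_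

  _~_ : Rel Carrier ℓ
  x ~ y = x ∨ 𝕔 ≈ y ∨ 𝕔

  _⇔_ : Rel Carrier ℓ
  x ⇔ y = ((x ⇒ y) ≈ 𝟙) × ((y ⇒ x) ≈ 𝟙)

  opaque
    ∼-∨ : ∀ x y → ∼ (x ∨ y) ≈ ∼ x ∧ ∼ y
    ∼-∨ x y = begin
      ∼ (x ∨ y)                  ≈⟨ ∼-cong (∨-cong (∼-invol x) (∼-invol y)) ⟨
      ∼ (∼ (∼ x) ∨ ∼ (∼ y))      ≈⟨ ∼-cong (∼-∧ (∼ x) (∼ y)) ⟨
      ∼ (∼ (∼ x ∧ ∼ y))          ≈⟨ ∼-invol _ ⟩
      ∼ x ∧ ∼ y                  ∎
      where open SetoidReasoning setoid

    ∼𝟙≈𝟘 : ∼ 𝟙 ≈ 𝟘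
    ∼𝟙≈𝟘 = begin
      ∼ 𝟙                  ≈⟨ ∨-identityʳ _ ⟨
      ∼ 𝟙 ∨ 𝟘              ≈⟨ ∨-congˡ (∼-invol 𝟘) ⟨
      ∼ 𝟙 ∨ ∼ (∼ 𝟘)        ≈⟨ ∼-∧ 𝟙 (∼ 𝟘) ⟨
      ∼ (𝟙 ∧ ∼ 𝟘)          ≈⟨ ∼-cong (∧-identityˡ _) ⟩
      ∼ (∼ 𝟘)              ≈⟨ ∼-invol 𝟘 ⟩
      𝟘                    ∎
      where open SetoidReasoning setoid

    ∼𝟘≈𝟙 : ∼ 𝟘 ≈ 𝟙
    ∼𝟘≈𝟙 = trans (∼-cong (sym ∼𝟙≈𝟘)) (∼-invol 𝟙)

    x∧∼x≤𝕔 : ∀ x → x ∧ ∼ x ≤ 𝕔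
    x∧∼x≤𝕔 x = trans (sym (CHNAlgebra.kleene T x 𝕔)) (∧-congˡ (trans (∨-congˡ ∼𝕔) (∨-idem 𝕔)))

    𝕔~𝟘 : 𝕔 ~ 𝟘
    𝕔~𝟘 = trans (∨-idem 𝕔) (sym (∨-identityˡ 𝕔))

    x∧∼x~𝟘 : ∀ x → x ∧ ∼ x ~ 𝟘
    x∧∼x~𝟘 x = trans (x≤y⇒x∨y≈y (x∧∼x≤𝕔 x)) (sym (∨-identityˡ 𝕔))

    ≈⇒⇔ : x ≈ y → x ⇔ y
    ≈⇒⇔ {x} x≈y = trans (⇒-cong refl (sym x≈y)) (hN1 x) , trans (⇒-cong (sym x≈y) refl) (hN1 x)

    ⇔-sym : x ⇔ y → y ⇔ x
    ⇔-sym (p , q) = q , p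

    ⇔-trans : x ⇔ y → y ⇔ z → x ⇔ z
    ⇔-trans {x} {y} {z} (p , q) (p′ , q′) = hN7 x y z p q p′ q′

    ∼⇒⇔∧∼ : ∀ x y → ∼ (x ⇒ y) ⇔ x ∧ ∼ y
    ∼⇒⇔∧∼ x y = hN3 x y , hN4 x y

    ∧⇒⇔∧∧⇒ : ∀ x y → x ∧ (x ⇒ y) ⇔ x ∧ y ∧ (x ⇒ y)
    ∧⇒⇔∧∧⇒ x y = hN6 x y , hN5 x y

    ∨-congʳ-⇔ : x ⇔ y → x ∨ z ⇔ y ∨ z
    ∨-congʳ-⇔ {x} {y} {z} (p , q) = hN9 x y z p q , hN9 y x z q p

    ⇒-congˡ-⇔ : x ⇔ x′ → (x ⇒ y) ⇔ (x′ ⇒ y)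
    ⇒-congˡ-⇔ {x} {x′} {y} (p , q) = proj₁ (hN10 x x′ y p q) , proj₁ (hN10 x′ x y q p)

    ⇒-congʳ-⇔ : y ⇔ y′ → (x ⇒ y) ⇔ (x ⇒ y′)
    ⇒-congʳ-⇔ {y} {y′} {x} (p , q) = proj₂ (hN10 y y′ x p q) , proj₂ (hN10 y′ y x q p)

    𝟘⇔𝕔 : 𝟘 ⇔ 𝕔
    𝟘⇔𝕔 = ⇔-trans (≈⇒⇔ (sym ∼[𝕔⇒𝕔]≈𝟘)) (⇔-trans (∼⇒⇔∧∼ 𝕔 𝕔) (≈⇒⇔ 𝕔∧∼𝕔≈𝕔))
      where
      ∼[𝕔⇒𝕔]≈𝟘 : ∼ (𝕔 ⇒ 𝕔) ≈ 𝟘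
      ∼[𝕔⇒𝕔]≈𝟘 = trans (∼-cong (hN1 𝕔)) ∼𝟙≈𝟘
      𝕔∧∼𝕔≈𝕔 : 𝕔 ∧ ∼ 𝕔 ≈ 𝕔
      𝕔∧∼𝕔≈𝕔 = trans (∧-congˡ ∼𝕔) (∧-idem 𝕔)

    x⇔x∨𝕔 : ∀ x → x ⇔ x ∨ 𝕔
    x⇔x∨𝕔 x = ⇔-trans (≈⇒⇔ (sym (∨-identityˡ x))) (⇔-trans (∨-congʳ-⇔ 𝟘⇔𝕔) (≈⇒⇔ (∨-comm 𝕔 x)))

    ~⇒⇔ : x ~ y → x ⇔ y
    ~⇒⇔ {x} {y} x~y = ⇔-trans (x⇔x∨𝕔 x) (⇔-trans (≈⇒⇔ x~y) (⇔-sym (x⇔x∨𝕔 y)))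

    ⇒≈𝟙⇒≤∨𝕔 : (x ⇒ y) ≈ 𝟙 → x ≤ y ∨ 𝕔
    ⇒≈𝟙⇒≤∨𝕔 {x} {y} x⇒y≈𝟙 = begin
      x                    ≈⟨ ∧-identityʳ x ⟨
      x ∧ 𝟙                ≈⟨ ∧-congˡ x⇒y≈𝟙 ⟨
      x ∧ (x ⇒ y)          ≤⟨ sym (hN2 x y) ⟩
      x ∧ (∼ x ∨ y)        ≈⟨ ∧-distribˡ-∨ x (∼ x) y ⟩
      x ∧ ∼ x ∨ x ∧ y      ≤⟨ ∨-monotonic (x∧∼x≤𝕔 x) (x∧y≤y x y) ⟩
      𝕔 ∨ y                ≈⟨ ∨-comm 𝕔 y ⟩
      y ∨ 𝕔                ∎
      where open PosetReasoning poset

    ⇔⇒~ : x ⇔ y → x ~ y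
    ⇔⇒~ (p , q) = ≤-antisym (∨-least (⇒≈𝟙⇒≤∨𝕔 p) (y≤x∨y _ _)) (∨-least (⇒≈𝟙⇒≤∨𝕔 q) (y≤x∨y _ _))

    ~-∼~⇒≈ : x ~ y → ∼ x ~ ∼ y → x ≈ y
    ~-∼~⇒≈ {x} {y} x~y ∼x~∼y = ∧-∨-cancelʳ (begin
      x ∧ 𝕔              ≈⟨ ∼[∼z∨𝕔]≈z∧𝕔 x ⟨
      ∼ (∼ x ∨ 𝕔)        ≈⟨ ∼-cong ∼x~∼y ⟩
      ∼ (∼ y ∨ 𝕔)        ≈⟨ ∼[∼z∨𝕔]≈z∧𝕔 y ⟩
      y ∧ 𝕔              ∎) x~y
      where
      open SetoidReasoning setoid
      ∼[∼z∨𝕔]≈z∧𝕔 : ∀ z → ∼ (∼ z ∨ 𝕔) ≈ z ∧ 𝕔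
      ∼[∼z∨𝕔]≈z∧𝕔 z = trans (∼-∨ (∼ z) 𝕔) (∧-cong (∼-invol z) ∼𝕔)

module CentreQuotient (T : CHNAlgebra ℓ) where
  open HemiNelsonProperties T

  ≈⇒~ : ∀ {x y} → x ≈ y → x ~ y
  ≈⇒~ = ∨-congʳ

  opaque
    ∧-cong-~ : Congruent₂ _~_ _∧_
    ∧-cong-~ {x} {x′} {y} {y′} x~x′ y~y′ = begin
      (x ∧ y) ∨ 𝕔             ≈⟨ ∨-distribʳ-∧ 𝕔 x y ⟩
      (x ∨ 𝕔) ∧ (y ∨ 𝕔)       ≈⟨ ∧-cong x~x′ y~y′ ⟩
      (x′ ∨ 𝕔) ∧ (y′ ∨ 𝕔)     ≈⟨ ∨-distribʳ-∧ 𝕔 x′ y′ ⟨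
      (x′ ∧ y′) ∨ 𝕔           ∎
      where open SetoidReasoning setoid

    ∨-cong-~ : Congruent₂ _~_ _∨_
    ∨-cong-~ {x} {x′} {y} {y′} x~x′ y~y′ = begin
      (x ∨ y) ∨ 𝕔             ≈⟨ ∨-distribʳ-∨ 𝕔 x y ⟩
      (x ∨ 𝕔) ∨ (y ∨ 𝕔)       ≈⟨ ∨-cong x~x′ y~y′ ⟩
      (x′ ∨ 𝕔) ∨ (y′ ∨ 𝕔)     ≈⟨ ∨-distribʳ-∨ 𝕔 x′ y′ ⟨
      (x′ ∨ y′) ∨ 𝕔           ∎
      where open SetoidReasoning setoid

    ⇒-cong-~ : Congruent₂ _~_ _⇒_
    ⇒-cong-~ x~x′ y~y′ = ⇔⇒~ (⇔-trans (⇒-congˡ-⇔ (~⇒⇔ x~x′)) (⇒-congʳ-⇔ (~⇒⇔ y~y′)))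

    ⇒-mp-~ : ∀ x y → (x ∧ (x ⇒ y)) ∧ y ~ x ∧ (x ⇒ y)
    ⇒-mp-~ x y = trans (≈⇒~ (trans (∧-assoc _ _ _) (∧-congˡ (∧-comm _ _))))
                       (⇔⇒~ (⇔-sym (∧⇒⇔∧∧⇒ x y)))

  -- The paper's interval [𝕔, 𝟙] of T, represented as T modulo x ↦ x ∨ 𝕔.
  hLattice : HLattice ℓ
  hLattice = record
    { Carrier = Carrier ; _≈_ = _~_ ; _∧_ = _∧_ ; _∨_ = _∨_ ; _⇒_ = _⇒_ ; 𝟘 = 𝟘 ; 𝟙 = 𝟙
    ; isBDL  = coarser-isBoundedDistributiveLattice
                 (record { refl = refl ; sym = sym ; trans = trans }) ≈⇒~ ∧-cong-~ ∨-cong-~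
    ; ⇒-cong = ⇒-cong-~
    ; ⇒-refl = λ x → ≈⇒~ (hN1 x)
    ; ⇒-mp   = ⇒-mp-~ }

module _ {A B : HLattice ℓ} (f : HLatticeHom A B) where
  private
    module A = Kalman A
    module B = Kalman B
  open HLatticeHom f
  open HLatticeProperties B using (refl; sym; trans)

  kalmanHom : CHNHom A.algebra B.algebra
  kalmanHom = record
    { fun   = λ (A.pair a b a∧b≈𝟘) → B.pair (fun a) (fun b)
                (trans (sym (hom-∧ a b)) (trans (cong a∧b≈𝟘) hom-𝟘))
    ; cong  = λ (p , q) → cong p , cong q
    ; hom-∧ = λ X Y → hom-∧ (A.fst X) (A.fst Y) , hom-∨ (A.snd X) (A.snd Y)
    ; hom-∨ = λ X Y → hom-∨ (A.fst X) (A.fst Y) , hom-∧ (A.snd X) (A.snd Y)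
    ; hom-⇒ = λ X Y → hom-⇒ (A.fst X) (A.fst Y) , hom-∧ (A.fst X) (A.snd Y)
    ; hom-∼ = λ _ → refl , refl
    ; hom-𝟘 = hom-𝟘 , hom-𝟙
    ; hom-𝟙 = hom-𝟙 , hom-𝟘
    ; hom-𝕔 = hom-𝟘 , hom-𝟘 }

module _ {T U : CHNAlgebra ℓ} (f : CHNHom T U) where
  private
    module T = CHNAlgebra T
    module U = HemiNelsonProperties U
    module U/𝕔 = CentreQuotient U
  open CHNHom f

  quotientHom : HLatticeHom (CentreQuotient.hLattice T) (CentreQuotient.hLattice U)
  quotientHom = record
    { fun   = fun
    ; cong  = λ {x} {y} x~y → begin
        fun x U.∨ U.𝕔          ≈⟨ U.∨-congˡ hom-𝕔 ⟨
        fun x U.∨ fun T.𝕔      ≈⟨ hom-∨ x T.𝕔 ⟨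
        fun (x T.∨ T.𝕔)        ≈⟨ cong x~y ⟩
        fun (y T.∨ T.𝕔)        ≈⟨ hom-∨ y T.𝕔 ⟩
        fun y U.∨ fun T.𝕔      ≈⟨ U.∨-congˡ hom-𝕔 ⟩
        fun y U.∨ U.𝕔          ∎
    ; hom-∧ = λ x y → U/𝕔.≈⇒~ (hom-∧ x y)
    ; hom-∨ = λ x y → U/𝕔.≈⇒~ (hom-∨ x y)
    ; hom-⇒ = λ x y → U/𝕔.≈⇒~ (hom-⇒ x y)
    ; hom-𝟘 = U/𝕔.≈⇒~ hom-𝟘
    ; hom-𝟙 = U/𝕔.≈⇒~ hom-𝟙 }
    where open SetoidReasoning U.setoid

kalmanFunctor : Functor (hIL ℓ) (KhILcCK ℓ)
kalmanFunctor = record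
  { F₀ = λ A → Kalman.algebra A , Kalman.isCK A
  ; F₁ = kalmanHom
  ; F-resp-≈ = λ f≈g X → f≈g (Kalman.fst X) , f≈g (Kalman.snd X)
  ; F-id = λ {A} _ → HLatticeProperties.refl A , HLatticeProperties.refl A
  ; F-∘ = λ {C′ = C} _ → HLatticeProperties.refl C , HLatticeProperties.refl C }

quotientFunctor : Functor (KhILcCK ℓ) (hIL ℓ)
quotientFunctor = record
  { F₀ = λ (T , _) → CentreQuotient.hLattice T
  ; F₁ = quotientHom
  ; F-resp-≈ = λ {_} {U} f≈g x → CentreQuotient.≈⇒~ (proj₁ U) (f≈g x)
  ; F-id = λ {T} _ → HemiNelsonProperties.refl (proj₁ T)
  ; F-∘ = λ {C′ = U} _ → HemiNelsonProperties.refl (proj₁ U) }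

module _ (A : HLattice ℓ) where
  open HLatticeProperties A
  open Kalman A

  unitFun : Carrier → Pair
  unitFun a = pair a 𝟘 (∧-zeroʳ a)

  unitHom : HLatticeHom A (CentreQuotient.hLattice algebra)
  unitHom = record
    { fun   = unitFun
    ; cong  = λ {a} {b} → fst≈⇒∨𝕔K≈ (unitFun a) (unitFun b)
    ; hom-∧ = λ a b → fst≈⇒∨𝕔K≈ (unitFun (a ∧ b)) (unitFun a ∧K unitFun b) refl
    ; hom-∨ = λ a b → fst≈⇒∨𝕔K≈ (unitFun (a ∨ b)) (unitFun a ∨K unitFun b) refl
    ; hom-⇒ = λ a b → fst≈⇒∨𝕔K≈ (unitFun (a ⇒ b)) (unitFun a ⇒K unitFun b) refl
    ; hom-𝟘 = fst≈⇒∨𝕔K≈ (unitFun 𝟘) 𝟘K refl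
    ; hom-𝟙 = fst≈⇒∨𝕔K≈ (unitFun 𝟙) 𝟙K refl }

  unitHom⁻¹ : HLatticeHom (CentreQuotient.hLattice algebra) A
  unitHom⁻¹ = record
    { fun = fst ; cong = λ {X} {Y} → ∨𝕔K≈⇒fst≈ X Y
    ; hom-∧ = λ _ _ → refl ; hom-∨ = λ _ _ → refl ; hom-⇒ = λ _ _ → refl
    ; hom-𝟘 = refl ; hom-𝟙 = refl }

unit : NaturalIsomorphism (idF (hIL ℓ)) (quotientFunctor ∘F kalmanFunctor)
unit = record
  { η       = unitHom
  ; η⁻¹     = unitHom⁻¹
  ; isoˡ    = λ A _ → HLatticeProperties.refl A
  ; isoʳ    = λ A X → Kalman.fst≈⇒∨𝕔K≈ A (unitFun A (Kalman.fst X)) X (HLatticeProperties.refl A)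
  ; commute = λ {A} {B} f a →
      Kalman.fst≈⇒∨𝕔K≈ B (unitFun B (HLatticeHom.fun f a)) (CHNHom.fun (kalmanHom f) (unitFun A a))
        (HLatticeProperties.refl B) }

module _ (T : CHNAlgebra ℓ) where
  open HemiNelsonProperties T
  open CentreQuotient T using (≈⇒~)
  private
    module K = Kalman (CentreQuotient.hLattice T)

  embed : CHNHom T K.algebra
  embed = record
    { fun   = λ x → K.pair x (∼ x) (x∧∼x~𝟘 x)
    ; cong  = λ x≈y → ≈⇒~ x≈y , ≈⇒~ (∼-cong x≈y)
    ; hom-∧ = λ x y → refl , ≈⇒~ (∼-∧ x y)
    ; hom-∨ = λ x y → refl , ≈⇒~ (∼-∨ x y)
    ; hom-⇒ = λ x y → refl , ⇔⇒~ (∼⇒⇔∧∼ x y)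
    ; hom-∼ = λ x → refl , ≈⇒~ (∼-invol x)
    ; hom-𝟘 = refl , ≈⇒~ ∼𝟘≈𝟙
    ; hom-𝟙 = refl , ≈⇒~ ∼𝟙≈𝟘
    ; hom-𝕔 = 𝕔~𝟘 , trans (≈⇒~ ∼𝕔) 𝕔~𝟘 }

  embed-injective : Injective _≈_ K._≈K_ (CHNHom.fun embed)
  embed-injective (x~y , ∼x~∼y) = ~-∼~⇒≈ x~y ∼x~∼y

  embed-surjective : CK T → StrictlySurjective K._≈K_ (CHNHom.fun embed)
  embed-surjective ck (K.pair a b a∧b~𝟘) =
    ck (a ∨ 𝕔) (b ∨ 𝕔) (sym (y≤x∨y a 𝕔)) (sym (y≤x∨y b 𝕔)) (sym (≤-reflexive meet≈𝕔))
    where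
    meet≈𝕔 : (a ∨ 𝕔) ∧ (b ∨ 𝕔) ≈ 𝕔
    meet≈𝕔 = trans (sym (∨-distribʳ-∧ 𝕔 a b)) (trans a∧b~𝟘 (∨-identityˡ 𝕔))

counit : NaturalIsomorphism (kalmanFunctor ∘F quotientFunctor) (idF (KhILcCK ℓ))
counit = symNI (record
  { η       = λ (T , _) → embed T
  ; η⁻¹     = λ (T , ck) → inverseHom (embed T) (embed-injective T) (embed-surjective T ck)
  ; isoˡ    = λ (T , ck) → inverse∘fun (embed T) (embed-injective T) (embed-surjective T ck)
  ; isoʳ    = λ (T , ck) → fun∘inverse (embed T) (embed-injective T) (embed-surjective T ck)
  ; commute = λ {_} {U} f x →
      HemiNelsonProperties.refl (proj₁ U) ,
      CentreQuotient.≈⇒~ (proj₁ U) (HemiNelsonProperties.sym (proj₁ U) (CHNHom.hom-∼ f x)) })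

theorem38 : (ℓ : Level) → CategoryEquivalence (hIL ℓ) (KhILcCK ℓ)
theorem38 ℓ = record { F = kalmanFunctor ; G = quotientFunctor ; unit = unit ; counit = counit }
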